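{- Let $B$ and $B'$ be skew-symmetric $n\times n$ integer matrices which are mutation equivalent, and let $A$ and $A'$ be quasi-Cartan companions of $B$ and $B'$ respectively. Then the associated quadratic forms $q_A$ and $q_{A'}$ on $\mathbb Z^n/2\mathbb Z^n$ are isomorphic.
   Context: Mutation in direction $k$ sends a skew-symmetric integer matrix $B$ to $B'=\mu_k(B)$ with $B'_{ij}=-B_{ij}$ if $i=k$ or $j=k$, and $B'_{ij}=B_{ij}+[B_{ik}]_+[B_{kj}]_+-[-B_{ik}]_+[-B_{kj}]_+$ otherwise, where $[b]_+=\max(b,0)$. Two skew-symmetric matrices are mutation equivalent if one is obtained from the other by a finite sequence of mutations. A quasi-Cartan companion of a skew-symmetric $B$ is a symmetric integer matrix $A$ with $A_{ii}=2$ for all $i$ and $|A_{ij}|=|B_{ij}|$ for all $i\ne j$. For a symmetric integer matrix $A$ with even diagonal, $q_A:\mathbb Z^n/2\mathbb Z^n\to\mathbb F_2$ is $q_A(v)=(v^TAv)/2\bmod 2$. Quadratic forms $q,q'$ on an $\mathbb F_2$-space $W$ are isomorphic if there is a linear isomorphism $T:W\to W$ with $q(T(x))=q'(x)$ for all $x$. -}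

module Defs where

open import Data.Nat as ℕ using (ℕ; zero; suc)
open import Data.Integer using (ℤ; +_; -_; _+_; _*_; _-_; ∣_∣)
open import Data.Integer.DivMod using (_/ℕ_; _%ℕ_)
open import Data.Fin using (Fin; zero; suc)
open import Data.Bool using (Bool; true; false; if_then_else_; _xor_; _∨_)
open import Data.Vec using (Vec; lookup; zipWith)
open import Data.Product using (Σ; ∃; _×_)
open import Relation.Binary.PropositionalEquality using (_≡_; _≢_)
open import Relation.Nullary using (does)
open import Relation.Binary.Construct.Closure.ReflexiveTransitive using (Star)

Mat : ℕ → Set
Mat n = Fin n → Fin n → ℤ

SkewSymmetric : ∀ {n} → Mat n → Set
SkewSymmetric B = ∀ i j → B i j ≡ - B j i

pos : ℤ → ℤ
pos (+ m) = + m
pos _     = + 0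

mutate : ∀ {n} → Fin n → Mat n → Mat n
mutate k B i j =
  if does (i Data.Fin.≟ k) ∨ does (j Data.Fin.≟ k)
  then - B i j
  else B i j + pos (B i k) * pos (B k j) - pos (- B i k) * pos (- B k j)


MutStep : ∀ {n} → Mat n → Mat n → Set
MutStep {n} B B′ = ∃ λ (k : Fin n) → ∀ i j → B′ i j ≡ mutate k B i j

MutationEquivalent : ∀ {n} → Mat n → Mat n → Set
MutationEquivalent = Star MutStep

QuasiCartanCompanion : ∀ {n} → Mat n → Mat n → Set
QuasiCartanCompanion {n} A B =
  (∀ i j → A i j ≡ A j i) ×
  (∀ i → A i i ≡ + 2) ×
  (∀ i j → i ≢ j → ∣ A i j ∣ ≡ ∣ B i j ∣)

sumFin : ∀ {n} → (Fin n → ℤ) → ℤ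
sumFin {zero}  f = + 0
sumFin {suc n} f = f zero + sumFin (λ i → f (suc i))

-- F₂ = Bool, vectors of Z^n/2Z^n = Vec Bool n
F2^ : ℕ → Set
F2^ n = Vec Bool n

lift : Bool → ℤ
lift true  = + 1
lift false = + 0

vAv : ∀ {n} → Mat n → F2^ n → ℤ
vAv A v = sumFin λ i → sumFin λ j → lift (lookup v i) * A i j * lift (lookup v j)

qForm : ∀ {n} → Mat n → F2^ n → Bool
qForm A v = ((vAv A v /ℕ 2) %ℕ 2) ℕ.≡ᵇ 1

_⊕_ : ∀ {n} → F2^ n → F2^ n → F2^ n
_⊕_ = zipWith _xor_

record LinearIso (n : ℕ) : Set where
  field
    to      : F2^ n → F2^ n
    from    : F2^ n → F2^ n
    to-linear : ∀ x y → to (x ⊕ y) ≡ to x ⊕ to y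
    from∘to : ∀ x → from (to x) ≡ x
    to∘from : ∀ x → to (from x) ≡ x

IsoQuadForms : ∀ {n} → (F2^ n → Bool) → (F2^ n → Bool) → Set
IsoQuadForms {n} q q′ = Σ (LinearIso n) λ T → ∀ x → q (LinearIso.to T x) ≡ q′ x

{-# OPTIONS --safe #-}
module Submission where

-- Since A is symmetric with diagonal 2, A = W + Wᵀ for the unit upper triangular W carrying the
-- entries of A above the diagonal, so vᵀAv = 2 vᵀWv and q_A(v) is the parity of vᵀWv.  Mod 2 this is
-- the F₂-quadratic form Σᵢ vᵢ + Σ_{i<j} bᵢⱼ vᵢ vⱼ of the parity matrix b of B (A and B agree mod 2 off
-- the diagonal), so q_A depends only on B.  Let cᵢ (resp. dᵢ) say that B i k is odd and positive
-- (resp. negative).  Mod 2, μ_k adds c dᵀ + d cᵀ to b, which adds (c·v)(d·v) to the form, since a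
-- quadratic form over F₂ is determined by its symmetrisation and its diagonal.  The transvection
-- v ↦ v + (c·v) e_k adds the same term, so it carries q_B to q_{μ_k B}; composing such transvections
-- along the mutation sequence gives the isomorphism.

open import Defs

open import Algebra.Bundles using (CommutativeSemiring; CommutativeRing)
open import Data.Bool using (Bool; true; false; not; _∧_; _xor_; if_then_else_)
open import Data.Bool.Properties
  using ( not-distribˡ-xor; not-involutive; xor-same; xor-identityʳ; xor-assoc; xor-comm
        ; xor-annihilates-not; ∧-zeroʳ; ∧-identityʳ; ∧-idem; ∧-comm; if-float; xor-∧-commutativeRing)
open import Data.Fin using (Fin; zero; suc)
open import Data.Fin.Properties using (_≟_; _<?_; <-cmp; <-asym; <-irrefl; <⇒≢)
open import Data.Integer using (ℤ; +_; -[1+_]; -_; _-_; ∣_∣; _⊖_)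
open import Data.Integer.DivMod using (_/ℕ_; _%ℕ_; a≡a%ℕn+[a/ℕn]*n; n%ℕd<d)
import Data.Integer.Properties as ℤ
open import Data.Integer.Solver using (module +-*-Solver)
open import Data.Nat as ℕ using (ℕ; zero; suc; s≤s)
open import Data.Product using (_,_; _×_)
open import Data.Vec using (lookup; tabulate)
open import Data.Vec.Functional using (Vector)
open import Data.Vec.Properties using (lookup∘tabulate; tabulate∘lookup; tabulate-cong; lookup-zipWith)
open import Function using (_∘_)
open import Relation.Binary using (tri<; tri≈; tri>)
open import Relation.Binary.PropositionalEquality
  using (_≡_; _≗_; refl; sym; trans; cong; cong₂; ≢-sym; module ≡-Reasoning)
open import Relation.Binary.Construct.Closure.ReflexiveTransitive using (ε; _◅_)
open import Relation.Nullary using (does; yes; no)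
open import Relation.Nullary.Decidable using (dec-true; dec-false)

module BilinearForms {c ℓ} (R : CommutativeSemiring c ℓ) where

  open CommutativeSemiring R hiding (zero) renaming (refl to ≈-refl; sym to ≈-sym; trans to ≈-trans)
  open import Algebra.Properties.Semiring.Sum semiring
    using ( sum; sum-syntax; sum-cong-≋; sum-replicate-zero; ∑-distrib-+; ∑-comm
          ; *-distribˡ-sum; *-distribʳ-sum)
  open import Algebra.Properties.CommutativeSemigroup +-commutativeSemigroup using (interchange)
  open import Algebra.Properties.CommutativeSemigroup *-commutativeSemigroup using (xy∙z≈zy∙x)
  open import Relation.Binary.Reasoning.Setoid setoid

  Matrix : ℕ → Set c
  Matrix n = Fin n → Fin n → Carrier

  private
    *-selectʳ : ∀ b a s → a * (if b then s else 0#) ≈ (if b then a * s else 0#)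
    *-selectʳ true  a s = ≈-refl
    *-selectʳ false a s = zeroʳ a

    *-selectˡ : ∀ b s a → (if b then s else 0#) * a ≈ (if b then s * a else 0#)
    *-selectˡ true  s a = ≈-refl
    *-selectˡ false s a = zeroˡ a

    ∑-select : ∀ {n} (k : Fin n) (f : Vector Carrier n) →
               ∑[ j < n ] (if does (j ≟ k) then f j else 0#) ≈ f k
    ∑-select {suc n} zero    f = ≈-trans (+-congˡ (sum-replicate-zero n)) (+-identityʳ (f zero))
    ∑-select {suc n} (suc k) f = ≈-trans (+-identityˡ _) (∑-select k (λ j → f (suc j)))

  module _ {n : ℕ} where

    bilinear : Matrix n → Vector Carrier n → Vector Carrier n → Carrier
    bilinear M x y = ∑[ i < n ] ∑[ j < n ] (x i * M i j * y j)

    quadratic : Matrix n → Vector Carrier n → Carrier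
    quadratic M x = bilinear M x x

    dot : Vector Carrier n → Vector Carrier n → Carrier
    dot x a = ∑[ i < n ] (x i * a i)

    basis : Fin n → Carrier → Vector Carrier n
    basis k s i = if does (i ≟ k) then s else 0#

    unitUpper : Matrix n → Matrix n
    unitUpper M i j = if does (i <? j) then M i j else if does (i ≟ j) then 1# else 0#

    private
      ∑∑-cong : {F G : Matrix n} → (∀ i j → F i j ≈ G i j) →
                ∑[ i < n ] ∑[ j < n ] F i j ≈ ∑[ i < n ] ∑[ j < n ] G i j
      ∑∑-cong F≈G = sum-cong-≋ {n} (λ i → sum-cong-≋ {n} (F≈G i))

      ∑∑-distrib-+ : (F G : Matrix n) →
                     ∑[ i < n ] ∑[ j < n ] (F i j + G i j) ≈
                     ∑[ i < n ] ∑[ j < n ] F i j + ∑[ i < n ] ∑[ j < n ] G i j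
      ∑∑-distrib-+ F G = ≈-trans (sum-cong-≋ {n} (λ i → ∑-distrib-+ (F i) (G i)))
                                 (∑-distrib-+ (λ i → sum (F i)) (λ i → sum (G i)))

    dot-+ˡ : ∀ x x′ a → dot (λ i → x i + x′ i) a ≈ dot x a + dot x′ a
    dot-+ˡ x x′ a = ≈-trans (sum-cong-≋ {n} (λ i → distribʳ (a i) (x i) (x′ i)))
                            (∑-distrib-+ (λ i → x i * a i) (λ i → x′ i * a i))

    dot-+ʳ : ∀ x a b → dot x (λ i → a i + b i) ≈ dot x a + dot x b
    dot-+ʳ x a b = ≈-trans (sum-cong-≋ {n} (λ i → distribˡ (x i) (a i) (b i)))
                           (∑-distrib-+ (λ i → x i * a i) (λ i → x i * b i))

    dot-basisˡ : ∀ k s a → dot (basis k s) a ≈ s * a k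
    dot-basisˡ k s a = ≈-trans (sum-cong-≋ {n} (λ i → *-selectˡ (does (i ≟ k)) s (a i)))
                               (∑-select k (λ i → s * a i))

    bilinear-cong : {M N : Matrix n} {x x′ y y′ : Vector Carrier n} → (∀ i j → M i j ≈ N i j) →
                    (∀ i → x i ≈ x′ i) → (∀ j → y j ≈ y′ j) → bilinear M x y ≈ bilinear N x′ y′
    bilinear-cong M≈N x≈x′ y≈y′ = ∑∑-cong (λ i j → *-cong (*-cong (x≈x′ i) (M≈N i j)) (y≈y′ j))

    bilinear-+ᴹ : ∀ (M N : Matrix n) x y →
                  bilinear (λ i j → M i j + N i j) x y ≈ bilinear M x y + bilinear N x y
    bilinear-+ᴹ M N x y = ≈-trans
      (∑∑-cong (λ i j → ≈-trans (*-congʳ (distribˡ (x i) (M i j) (N i j))) (distribʳ (y j) _ _)))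
      (∑∑-distrib-+ _ _)

    bilinear-+ˡ : ∀ (M : Matrix n) x x′ y →
                  bilinear M (λ i → x i + x′ i) y ≈ bilinear M x y + bilinear M x′ y
    bilinear-+ˡ M x x′ y = ≈-trans
      (∑∑-cong (λ i j → ≈-trans (*-congʳ (distribʳ (M i j) (x i) (x′ i))) (distribʳ (y j) _ _)))
      (∑∑-distrib-+ _ _)

    bilinear-+ʳ : ∀ (M : Matrix n) x y y′ →
                  bilinear M x (λ j → y j + y′ j) ≈ bilinear M x y + bilinear M x y′
    bilinear-+ʳ M x y y′ = ≈-trans
      (∑∑-cong (λ i j → distribˡ (x i * M i j) (y j) (y′ j)))
      (∑∑-distrib-+ _ _)

    bilinear-transpose : ∀ (M : Matrix n) x y → bilinear (λ i j → M j i) x y ≈ bilinear M y x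
    bilinear-transpose M x y = ≈-trans (∑-comm (λ i j → x i * M j i * y j))
                                       (∑∑-cong (λ j i → xy∙z≈zy∙x (x i) (M j i) (y j)))

    quadratic-+ : ∀ (M : Matrix n) x y →
                  quadratic M (λ i → x i + y i) ≈
                  (quadratic M x + quadratic M y) + bilinear (λ i j → M i j + M j i) x y
    quadratic-+ M x y = begin
      bilinear M (λ i → x i + y i) (λ i → x i + y i)
        ≈⟨ bilinear-+ˡ M x y _ ⟩
      bilinear M x (λ i → x i + y i) + bilinear M y (λ i → x i + y i)
        ≈⟨ +-cong (bilinear-+ʳ M x x y) (bilinear-+ʳ M y x y) ⟩
      (quadratic M x + bilinear M x y) + (bilinear M y x + quadratic M y)
        ≈⟨ +-congˡ (+-comm _ _) ⟩
      (quadratic M x + bilinear M x y) + (quadratic M y + bilinear M y x)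
        ≈⟨ interchange _ _ _ _ ⟩
      (quadratic M x + quadratic M y) + (bilinear M x y + bilinear M y x)
        ≈⟨ +-congˡ (+-congˡ (≈-sym (bilinear-transpose M x y))) ⟩
      (quadratic M x + quadratic M y) + (bilinear M x y + bilinear (λ i j → M j i) x y)
        ≈⟨ +-congˡ (≈-sym (bilinear-+ᴹ M (λ i j → M j i) x y)) ⟩
      (quadratic M x + quadratic M y) + bilinear (λ i j → M i j + M j i) x y ∎

    quadratic-symmetrisation : {M : Matrix n} (W : Matrix n) → (∀ i j → M i j ≈ W i j + W j i) →
                               ∀ x → quadratic M x ≈ quadratic W x + quadratic W x
    quadratic-symmetrisation W M≈W+Wᵀ x = begin
      quadratic _ x                                 ≈⟨ bilinear-cong M≈W+Wᵀ (λ _ → ≈-refl) (λ _ → ≈-refl) ⟩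
      bilinear (λ i j → W i j + W j i) x x          ≈⟨ bilinear-+ᴹ W (λ i j → W j i) x x ⟩
      quadratic W x + bilinear (λ i j → W j i) x x  ≈⟨ +-congˡ (bilinear-transpose W x x) ⟩
      quadratic W x + quadratic W x                 ∎

    bilinear-outer : ∀ (a b : Vector Carrier n) x y →
                     bilinear (λ i j → a i * b j) x y ≈ dot x a * dot y b
    bilinear-outer a b x y = begin
      bilinear (λ i j → a i * b j) x y
        ≈⟨ ∑∑-cong (λ i j → regroup (x i) (a i) (b j) (y j)) ⟩
      ∑[ i < n ] ∑[ j < n ] ((x i * a i) * (y j * b j))
        ≈⟨ sum-cong-≋ {n} (λ i → ≈-sym (*-distribˡ-sum (x i * a i) (λ j → y j * b j))) ⟩
      ∑[ i < n ] ((x i * a i) * dot y b)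
        ≈⟨ ≈-sym (*-distribʳ-sum (dot y b) (λ i → x i * a i)) ⟩
      dot x a * dot y b ∎
      where
      regroup : ∀ u v w z → u * (v * w) * z ≈ (u * v) * (z * w)
      regroup u v w z =
        ≈-trans (*-congʳ (≈-sym (*-assoc u v w))) (≈-trans (*-assoc _ w z) (*-congˡ (*-comm w z)))

    bilinear-basisʳ : ∀ (M : Matrix n) x k s →
                      bilinear M x (basis k s) ≈ dot x (λ i → M i k) * s
    bilinear-basisʳ M x k s = begin
      bilinear M x (basis k s)
        ≈⟨ ∑∑-cong (λ i j → *-selectʳ (does (j ≟ k)) (x i * M i j) s) ⟩
      ∑[ i < n ] ∑[ j < n ] (if does (j ≟ k) then x i * M i j * s else 0#)
        ≈⟨ sum-cong-≋ {n} (λ i → ∑-select k (λ j → x i * M i j * s)) ⟩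
      ∑[ i < n ] (x i * M i k * s)
        ≈⟨ ≈-sym (*-distribʳ-sum s (λ i → x i * M i k)) ⟩
      dot x (λ i → M i k) * s ∎

    quadratic-basis : ∀ (M : Matrix n) k s → quadratic M (basis k s) ≈ s * M k k * s
    quadratic-basis M k s =
      ≈-trans (bilinear-basisʳ M (basis k s) k s) (*-congʳ (dot-basisˡ k s (λ i → M i k)))

    unitUpper-diagonal : ∀ (M : Matrix n) i → unitUpper M i i ≡ 1#
    unitUpper-diagonal M i rewrite dec-false (i <? i) (<-irrefl refl) | dec-true (i ≟ i) refl = refl

    -- The diagonal condition reads M i i = 2 over ℤ and M i i = 0 over 𝔽₂.
    unitUpper-symmetrisation : (M : Matrix n) → (∀ i j → M i j ≈ M j i) → (∀ i → M i i ≈ 1# + 1#) →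
                               ∀ i j → unitUpper M i j + unitUpper M j i ≈ M i j
    unitUpper-symmetrisation M M-sym M-diag i j with <-cmp i j
    ... | tri< i<j _ _
      rewrite dec-true (i <? j) i<j | dec-false (j <? i) (<-asym i<j) | dec-false (j ≟ i) (≢-sym (<⇒≢ i<j))
      = +-identityʳ (M i j)
    ... | tri> _ _ j<i
      rewrite dec-true (j <? i) j<i | dec-false (i <? j) (<-asym j<i) | dec-false (i ≟ j) (≢-sym (<⇒≢ j<i))
      = ≈-trans (+-identityˡ (M j i)) (M-sym j i)
    ... | tri≈ _ refl _
      rewrite dec-false (i <? i) (<-irrefl refl) | dec-true (i ≟ i) refl
      = ≈-sym (M-diag i)

-- Opened only now: inside BilinearForms, _+_ and _*_ are the semiring operations.
open import Data.Integer using (_+_; _*_)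

oddℕ : ℕ → Bool
oddℕ zero    = false
oddℕ (suc n) = not (oddℕ n)

odd : ℤ → Bool
odd a = oddℕ ∣ a ∣

oddℕ-+ : ∀ m n → oddℕ (m ℕ.+ n) ≡ oddℕ m xor oddℕ n
oddℕ-+ zero    n = refl
oddℕ-+ (suc m) n rewrite oddℕ-+ m n = not-distribˡ-xor (oddℕ m) (oddℕ n)

oddℕ-* : ∀ m n → oddℕ (m ℕ.* n) ≡ oddℕ m ∧ oddℕ n
oddℕ-* zero    n = refl
oddℕ-* (suc m) n rewrite oddℕ-+ n (m ℕ.* n) | oddℕ-* m n = add-product (oddℕ m) (oddℕ n)
  where
  add-product : ∀ a b → b xor (a ∧ b) ≡ not a ∧ b
  add-product false b = xor-identityʳ b
  add-product true  b = xor-same b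

odd-⊖ : ∀ m n → odd (m ⊖ n) ≡ oddℕ m xor oddℕ n
odd-⊖ zero    zero    = refl
odd-⊖ zero    (suc n) = refl
odd-⊖ (suc m) zero    = sym (xor-identityʳ _)
odd-⊖ (suc m) (suc n) rewrite ℤ.[1+m]⊖[1+n]≡m⊖n m n | odd-⊖ m n =
  sym (xor-annihilates-not (oddℕ m) (oddℕ n))

odd-+ : ∀ a b → odd (a + b) ≡ odd a xor odd b
odd-+ (+ m)    (+ n)    = oddℕ-+ m n
odd-+ (+ m)    -[1+ n ] = odd-⊖ m (suc n)
odd-+ -[1+ m ] (+ n)    = trans (odd-⊖ n (suc m)) (xor-comm (oddℕ n) _)
odd-+ -[1+ m ] -[1+ n ] rewrite oddℕ-+ m n =
  trans (not-involutive _) (sym (xor-annihilates-not (oddℕ m) (oddℕ n)))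

odd-neg : ∀ a → odd (- a) ≡ odd a
odd-neg a = cong oddℕ (ℤ.∣-i∣≡∣i∣ a)

odd-- : ∀ a b → odd (a - b) ≡ odd a xor odd b
odd-- a b = trans (odd-+ a (- b)) (cong (odd a xor_) (odd-neg b))

odd-* : ∀ a b → odd (a * b) ≡ odd a ∧ odd b
odd-* a b = trans (cong oddℕ (ℤ.abs-* a b)) (oddℕ-* ∣ a ∣ ∣ b ∣)

odd-lift : ∀ b → odd (lift b) ≡ b
odd-lift true  = refl
odd-lift false = refl

private
  oddℕ-remainder : ∀ a → oddℕ (a %ℕ 2) ≡ odd a
  oddℕ-remainder a = sym (begin
    odd a                                   ≡⟨ cong odd (a≡a%ℕn+[a/ℕn]*n a 2) ⟩
    odd (+ (a %ℕ 2) + (a /ℕ 2) * + 2)       ≡⟨ odd-+ (+ (a %ℕ 2)) ((a /ℕ 2) * + 2) ⟩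
    oddℕ (a %ℕ 2) xor odd ((a /ℕ 2) * + 2)  ≡⟨ cong (oddℕ (a %ℕ 2) xor_) (odd-* (a /ℕ 2) (+ 2)) ⟩
    oddℕ (a %ℕ 2) xor (odd (a /ℕ 2) ∧ false) ≡⟨ cong (oddℕ (a %ℕ 2) xor_) (∧-zeroʳ _) ⟩
    oddℕ (a %ℕ 2) xor false                 ≡⟨ xor-identityʳ _ ⟩
    oddℕ (a %ℕ 2)                           ∎)
    where open ≡-Reasoning

  ≡ᵇ1-oddℕ : ∀ {r} → r ℕ.< 2 → (r ℕ.≡ᵇ 1) ≡ oddℕ r
  ≡ᵇ1-oddℕ {0} _ = refl
  ≡ᵇ1-oddℕ {1} _ = refl
  ≡ᵇ1-oddℕ {suc (suc _)} (s≤s (s≤s ()))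

  even-digit : ∀ {r} → r ℕ.< 2 → oddℕ r ≡ false → r ≡ 0
  even-digit {0} _ _ = refl
  even-digit {1} _ ()
  even-digit {suc (suc _)} (s≤s (s≤s ())) _

  a+a≡a*2 : ∀ a → a + a ≡ a * + 2
  a+a≡a*2 a = sym (trans (ℤ.*-distribˡ-+ a (+ 1) (+ 1)) (cong₂ _+_ (ℤ.*-identityʳ a) (ℤ.*-identityʳ a)))

%ℕ2≡ᵇ1 : ∀ a → ((a %ℕ 2) ℕ.≡ᵇ 1) ≡ odd a
%ℕ2≡ᵇ1 a = trans (≡ᵇ1-oddℕ (n%ℕd<d a 2)) (oddℕ-remainder a)

[a+a]/ℕ2≡a : ∀ a → (a + a) /ℕ 2 ≡ a
[a+a]/ℕ2≡a a = sym (ℤ.*-cancelʳ-≡ a q (+ 2) (begin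
  a * + 2                        ≡⟨ sym (a+a≡a*2 a) ⟩
  a + a                          ≡⟨ a≡a%ℕn+[a/ℕn]*n (a + a) 2 ⟩
  + ((a + a) %ℕ 2) + q * + 2     ≡⟨ cong (λ r → + r + q * + 2) remainder≡0 ⟩
  + 0 + q * + 2                  ≡⟨ ℤ.+-identityˡ _ ⟩
  q * + 2                        ∎))
  where
  open ≡-Reasoning
  q = (a + a) /ℕ 2
  remainder≡0 : (a + a) %ℕ 2 ≡ 0
  remainder≡0 = even-digit (n%ℕd<d (a + a) 2)
                           (trans (oddℕ-remainder (a + a)) (trans (odd-+ a a) (xor-same (odd a))))

𝔽₂ : CommutativeSemiring _ _
𝔽₂ = CommutativeRing.commutativeSemiring xor-∧-commutativeRing

open BilinearForms 𝔽₂
module ℤForms = BilinearForms ℤ.+-*-commutativeSemiring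
open import Algebra.Properties.Semiring.Sum (CommutativeSemiring.semiring 𝔽₂)
  using (sum; sum-syntax; sum-cong-≋; ∑-distrib-+)
import Algebra.Properties.Semiring.Sum (CommutativeSemiring.semiring ℤ.+-*-commutativeSemiring) as ℤSum
open import Algebra.Properties.CommutativeSemigroup (CommutativeSemiring.+-commutativeSemigroup 𝔽₂)
  using (interchange)
open import Algebra.Properties.CommutativeSemigroup (CommutativeSemiring.*-commutativeSemigroup 𝔽₂)
  using (xy∙z≈zy∙x)

xor≡false⇒≡ : ∀ {a b} → a xor b ≡ false → a ≡ b
xor≡false⇒≡ {false} {false} _ = refl
xor≡false⇒≡ {true}  {true}  _ = refl

∑∑-alternating : ∀ {n} (F : Matrix n) → (∀ i → F i i ≡ false) → (∀ i j → F i j ≡ F j i) →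
                 ∑[ i < n ] ∑[ j < n ] F i j ≡ false
∑∑-alternating {zero}  F diag symm = refl
∑∑-alternating {suc n} F diag symm = begin
  (F zero zero xor r) xor ∑[ i < n ] (F (suc i) zero xor ∑[ j < n ] F (suc i) (suc j))
    ≡⟨ cong₂ _xor_ (cong (_xor r) (diag zero)) (∑-distrib-+ (λ i → F (suc i) zero) (λ i → sum (F′ i))) ⟩
  r xor (∑[ i < n ] F (suc i) zero xor ∑[ i < n ] ∑[ j < n ] F′ i j)
    ≡⟨ cong₂ (λ u v → r xor (u xor v)) (sum-cong-≋ {n} (λ i → symm (suc i) zero))
             (∑∑-alternating F′ (λ i → diag (suc i)) (λ i j → symm (suc i) (suc j))) ⟩
  r xor (r xor false)
    ≡⟨ cong (r xor_) (xor-identityʳ r) ⟩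
  r xor r
    ≡⟨ xor-same r ⟩
  false ∎
  where
  open ≡-Reasoning
  r = ∑[ j < n ] F zero (suc j)
  F′ : Matrix n
  F′ i j = F (suc i) (suc j)

quadratic-alternating : ∀ {n} (M : Matrix n) → (∀ i → M i i ≡ false) → (∀ i j → M i j ≡ M j i) →
                        ∀ x → quadratic M x ≡ false
quadratic-alternating M diag symm x = ∑∑-alternating (λ i j → (x i ∧ M i j) ∧ x j)
  (λ i → trans (cong (λ m → (x i ∧ m) ∧ x i) (diag i)) (cong (_∧ x i) (∧-zeroʳ (x i))))
  (λ i j → trans (cong (λ m → (x i ∧ m) ∧ x j) (symm i j)) (xy∙z≈zy∙x (x i) (M j i) (x j)))

quadratic-cong : ∀ {n} (M N : Matrix n) →
                 (∀ i j → M i j xor M j i ≡ N i j xor N j i) → (∀ i → M i i ≡ N i i) →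
                 ∀ x → quadratic M x ≡ quadratic N x
quadratic-cong M N M+Mᵀ≡N+Nᵀ diag x = xor≡false⇒≡ (begin
  quadratic M x xor quadratic N x  ≡⟨ sym (bilinear-+ᴹ M N x x) ⟩
  quadratic D x                    ≡⟨ quadratic-alternating D D-diag D-symm x ⟩
  false                            ∎)
  where
  open ≡-Reasoning
  D : Matrix _
  D i j = M i j xor N i j
  D-diag : ∀ i → D i i ≡ false
  D-diag i = trans (cong (_xor N i i) (diag i)) (xor-same (N i i))
  D-symm : ∀ i j → D i j ≡ D j i
  D-symm i j = xor≡false⇒≡ (begin
    D i j xor D j i                          ≡⟨ interchange (M i j) (N i j) (M j i) (N j i) ⟩
    (M i j xor M j i) xor (N i j xor N j i)  ≡⟨ cong (_xor _) (M+Mᵀ≡N+Nᵀ i j) ⟩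
    (N i j xor N j i) xor (N i j xor N j i)  ≡⟨ xor-same (N i j xor N j i) ⟩
    false                                    ∎)

parityMatrix : ∀ {n} → Mat n → Matrix n
parityMatrix B i j = odd (B i j)

mod2Form : ∀ {n} → Mat n → Vector Bool n → Bool
mod2Form B = quadratic (unitUpper (parityMatrix B))

mod2Form-cong : ∀ {n} {B B′ : Mat n} {x y : Vector Bool n} → (∀ i j → B i j ≡ B′ i j) → x ≗ y →
                mod2Form B x ≡ mod2Form B′ y
mod2Form-cong B≡B′ x≗y =
  bilinear-cong (λ i j → cong (if does (i <? j) then_else _) (cong odd (B≡B′ i j))) x≗y x≗y

skew-diagonal : ∀ {n} {B : Mat n} → SkewSymmetric B → ∀ i → B i i ≡ + 0
skew-diagonal skew i = self-negating (skew i i)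
  where
  self-negating : ∀ {a} → a ≡ - a → a ≡ + 0
  self-negating {+ zero} _ = refl

parityMatrix-symmetric : ∀ {n} {B : Mat n} → SkewSymmetric B →
                         ∀ i j → parityMatrix B i j ≡ parityMatrix B j i
parityMatrix-symmetric {B = B} skew i j = trans (cong odd (skew i j)) (odd-neg (B j i))

parityMatrix-diagonal : ∀ {n} {B : Mat n} → SkewSymmetric B → ∀ i → parityMatrix B i i ≡ false
parityMatrix-diagonal skew i = cong odd (skew-diagonal skew i)

companion-parityMatrix : ∀ {n} {A B : Mat n} → QuasiCartanCompanion A B → SkewSymmetric B →
                         ∀ i j → parityMatrix A i j ≡ parityMatrix B i j
companion-parityMatrix (_ , A-diag , A≈B) skew i j with i ≟ j
... | yes refl = trans (cong odd (A-diag i)) (sym (parityMatrix-diagonal skew i))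
... | no  i≢j  = cong oddℕ (A≈B i j i≢j)

sumFin≡sum : ∀ {n} (f : Fin n → ℤ) → sumFin f ≡ ℤSum.sum f
sumFin≡sum {zero}  f = refl
sumFin≡sum {suc n} f = cong (λ s → f zero + s) (sumFin≡sum (λ i → f (suc i)))

odd-sum : ∀ {n} (f : Fin n → ℤ) → odd (ℤSum.sum f) ≡ ∑[ i < n ] odd (f i)
odd-sum {zero}  f = refl
odd-sum {suc n} f = trans (odd-+ (f zero) _) (cong (odd (f zero) xor_) (odd-sum (λ i → f (suc i))))

odd-bilinear : ∀ {n} (M : Mat n) x y →
               odd (ℤForms.bilinear M x y) ≡ bilinear (parityMatrix M) (odd ∘ x) (odd ∘ y)
odd-bilinear {n} M x y =
  trans (odd-sum (λ i → ℤSum.sum (λ j → x i * M i j * y j))) (sum-cong-≋ {n} λ i →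
  trans (odd-sum (λ j → x i * M i j * y j)) (sum-cong-≋ {n} λ j →
  trans (odd-* (x i * M i j) (y j)) (cong (_∧ odd (y j)) (odd-* (x i) (M i j)))))

odd-unitUpper : ∀ {n} {M : Mat n} {P : Matrix n} → (∀ i j → odd (M i j) ≡ P i j) →
                ∀ i j → odd (ℤForms.unitUpper M i j) ≡ unitUpper P i j
odd-unitUpper odd-M≡P i j = trans (if-float odd (does (i <? j)))
  (cong₂ (if does (i <? j) then_else_) (odd-M≡P i j) (if-float odd (does (i ≟ j))))

vAv≡quadratic : ∀ {n} (A : Mat n) v → vAv A v ≡ ℤForms.quadratic A (lift ∘ lookup v)
vAv≡quadratic {n} A v = trans (sumFin≡sum (λ i → sumFin (λ j → x i * A i j * x j)))
                              (ℤSum.sum-cong-≋ {n} (λ i → sumFin≡sum (λ j → x i * A i j * x j)))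
  where
  x : Fin n → ℤ
  x = lift ∘ lookup v

qForm≡mod2Form : ∀ {n} {A B : Mat n} → QuasiCartanCompanion A B → SkewSymmetric B →
                 ∀ v → qForm A v ≡ mod2Form B (lookup v)
qForm≡mod2Form {A = A} {B} companion@(A-symm , A-diag , _) skew v = begin
  qForm A v
    ≡⟨ cong (λ a → ((a /ℕ 2) %ℕ 2) ℕ.≡ᵇ 1) vAv≡h+h ⟩
  (((h + h) /ℕ 2) %ℕ 2) ℕ.≡ᵇ 1
    ≡⟨ cong (λ a → (a %ℕ 2) ℕ.≡ᵇ 1) ([a+a]/ℕ2≡a h) ⟩
  (h %ℕ 2) ℕ.≡ᵇ 1
    ≡⟨ %ℕ2≡ᵇ1 h ⟩
  odd h
    ≡⟨ odd-bilinear W x x ⟩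
  bilinear (parityMatrix W) (odd ∘ x) (odd ∘ x)
    ≡⟨ bilinear-cong (odd-unitUpper (companion-parityMatrix companion skew)) odd-x odd-x ⟩
  mod2Form B (lookup v) ∎
  where
  open ≡-Reasoning
  x : Fin _ → ℤ
  x = lift ∘ lookup v
  odd-x : odd ∘ x ≗ lookup v
  odd-x i = odd-lift (lookup v i)
  W = ℤForms.unitUpper A
  h = ℤForms.quadratic W x
  vAv≡h+h : vAv A v ≡ h + h
  vAv≡h+h = trans (vAv≡quadratic A v) (ℤForms.quadratic-symmetrisation W
    (λ i j → sym (ℤForms.unitUpper-symmetrisation A A-symm A-diag i j)) x)

odd-pos-split : ∀ a → odd a ≡ odd (pos a) xor odd (pos (- a))
odd-pos-split (+ zero)  = refl
odd-pos-split (+ suc m) = sym (xor-identityʳ _)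
odd-pos-split -[1+ m ]  = refl

odd-pos-disjoint : ∀ a → odd (pos a) ∧ odd (pos (- a)) ≡ false
odd-pos-disjoint (+ zero)  = refl
odd-pos-disjoint (+ suc m) = ∧-zeroʳ _
odd-pos-disjoint -[1+ m ]  = refl

mutate-skew : ∀ {n} {B : Mat n} → SkewSymmetric B → ∀ k → SkewSymmetric (mutate k B)
mutate-skew {B = B} skew k i j with i ≟ k | j ≟ k
... | yes refl | yes refl = cong -_ (skew i j)
... | yes refl | no _     = cong -_ (skew i j)
... | no _     | yes refl = cong -_ (skew i j)
... | no _     | no _
  rewrite skew j i | skew j k | skew k i | ℤ.neg-involutive (B k j) | ℤ.neg-involutive (B i k) =
  solve 5 (λ b p q p′ q′ → b :+ p :* q :- p′ :* q′ := :- (:- b :+ q′ :* p′ :- q :* p))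
    refl (B i j) (pos (B i k)) (pos (B k j)) (pos (- B i k)) (pos (- B k j))
  where open +-*-Solver

module Mutation {n} {B : Mat n} (skew : SkewSymmetric B) (k : Fin n) where

  P P′ : Matrix n
  P  = parityMatrix B
  P′ = parityMatrix (mutate k B)

  c d : Vector Bool n
  c i = odd (pos (B i k))
  d i = odd (pos (- B i k))

  c-k : c k ≡ false
  c-k = cong (λ b → odd (pos b)) (skew-diagonal skew k)

  d-k : d k ≡ false
  d-k = cong (λ b → odd (pos (- b))) (skew-diagonal skew k)

  odd-exchange : ∀ i j → odd (pos (B i k) * pos (B k j)) xor odd (pos (- B i k) * pos (- B k j)) ≡
                         (c i ∧ d j) xor (c j ∧ d i)
  odd-exchange i j = cong₂ _xor_ odd-X odd-Y
    where
    open ≡-Reasoning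
    odd-X : odd (pos (B i k) * pos (B k j)) ≡ c i ∧ d j
    odd-X = trans (odd-* (pos (B i k)) (pos (B k j))) (cong (λ b → c i ∧ odd (pos b)) (skew k j))
    odd-Y : odd (pos (- B i k) * pos (- B k j)) ≡ c j ∧ d i
    odd-Y = begin
      odd (pos (- B i k) * pos (- B k j))  ≡⟨ odd-* (pos (- B i k)) (pos (- B k j)) ⟩
      d i ∧ odd (pos (- B k j))            ≡⟨ cong (λ b → d i ∧ odd (pos (- b))) (skew k j) ⟩
      d i ∧ odd (pos (- - B j k))          ≡⟨ cong (λ b → d i ∧ odd (pos b)) (ℤ.neg-involutive (B j k)) ⟩
      d i ∧ c j                            ≡⟨ ∧-comm (d i) (c j) ⟩
      c j ∧ d i                            ∎

  odd-mutate : ∀ i j → P′ i j ≡ P i j xor ((c i ∧ d j) xor (c j ∧ d i))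
  odd-mutate i j with i ≟ k | j ≟ k
  ... | yes refl | _ = trans (odd-neg (B k j)) (sym (begin
    P k j xor ((c k ∧ d j) xor (c j ∧ d k))  ≡⟨ cong₂ (λ u v → P k j xor ((u ∧ d j) xor (c j ∧ v))) c-k d-k ⟩
    P k j xor (false xor (c j ∧ false))      ≡⟨ cong (P k j xor_) (∧-zeroʳ (c j)) ⟩
    P k j xor false                          ≡⟨ xor-identityʳ _ ⟩
    P k j                                    ∎))
    where open ≡-Reasoning
  ... | no _ | yes refl = trans (odd-neg (B i k)) (sym (begin
    P i k xor ((c i ∧ d k) xor (c k ∧ d i))  ≡⟨ cong₂ (λ u v → P i k xor ((c i ∧ u) xor (v ∧ d i))) d-k c-k ⟩
    P i k xor ((c i ∧ false) xor false)      ≡⟨ cong (λ u → P i k xor (u xor false)) (∧-zeroʳ (c i)) ⟩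
    P i k xor false                          ≡⟨ xor-identityʳ _ ⟩
    P i k                                    ∎))
    where open ≡-Reasoning
  ... | no _ | no _ = begin
    odd (B i j + X - Y)                      ≡⟨ odd-- (B i j + X) Y ⟩
    odd (B i j + X) xor odd Y                ≡⟨ cong (_xor odd Y) (odd-+ (B i j) X) ⟩
    (P i j xor odd X) xor odd Y              ≡⟨ xor-assoc (P i j) (odd X) (odd Y) ⟩
    P i j xor (odd X xor odd Y)              ≡⟨ cong (P i j xor_) (odd-exchange i j) ⟩
    P i j xor ((c i ∧ d j) xor (c j ∧ d i))  ∎
    where
    open ≡-Reasoning
    X = pos (B i k) * pos (B k j)
    Y = pos (- B i k) * pos (- B k j)

  U : Matrix n
  U = unitUpper P

  U-symmetrisation : ∀ i j → U i j xor U j i ≡ P i j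
  U-symmetrisation = unitUpper-symmetrisation P (parityMatrix-symmetric skew) (parityMatrix-diagonal skew)

  transvection : Vector Bool n → Vector Bool n
  transvection x i = x i xor basis k (dot x c) i

  mod2Form-transvection : ∀ x → mod2Form B (transvection x) ≡ mod2Form B x xor (dot x c ∧ dot x d)
  mod2Form-transvection x = begin
    quadratic U (λ i → x i xor e i)
      ≡⟨ quadratic-+ U x e ⟩
    (quadratic U x xor quadratic U e) xor bilinear (λ i j → U i j xor U j i) x e
      ≡⟨ cong₂ (λ u v → (quadratic U x xor u) xor v) quadratic-e bilinear-e ⟩
    (quadratic U x xor t) xor ((t xor s) ∧ t)
      ≡⟨ xor-assoc (quadratic U x) t _ ⟩
    quadratic U x xor (t xor ((t xor s) ∧ t))
      ≡⟨ cong (quadratic U x xor_) (absorb t s) ⟩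
    quadratic U x xor (t ∧ s) ∎
    where
    open ≡-Reasoning
    t = dot x c
    s = dot x d
    e = basis k t

    quadratic-e : quadratic U e ≡ t
    quadratic-e = begin
      quadratic U e    ≡⟨ quadratic-basis U k t ⟩
      (t ∧ U k k) ∧ t  ≡⟨ cong (λ u → (t ∧ u) ∧ t) (unitUpper-diagonal P k) ⟩
      (t ∧ true) ∧ t   ≡⟨ cong (_∧ t) (∧-identityʳ t) ⟩
      t ∧ t            ≡⟨ ∧-idem t ⟩
      t                ∎

    bilinear-e : bilinear (λ i j → U i j xor U j i) x e ≡ (t xor s) ∧ t
    bilinear-e = begin
      bilinear (λ i j → U i j xor U j i) x e
        ≡⟨ bilinear-cong U-symmetrisation (λ i → refl {x = x i}) (λ j → refl {x = e j}) ⟩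
      bilinear P x e
        ≡⟨ bilinear-basisʳ P x k t ⟩
      dot x (λ i → P i k) ∧ t
        ≡⟨ cong (_∧ t) (sum-cong-≋ {n} (λ i → cong (x i ∧_) (odd-pos-split (B i k)))) ⟩
      dot x (λ i → c i xor d i) ∧ t
        ≡⟨ cong (_∧ t) (dot-+ʳ x c d) ⟩
      (t xor s) ∧ t ∎

    absorb : ∀ t s → t xor ((t xor s) ∧ t) ≡ t ∧ s
    absorb false false = refl
    absorb false true  = refl
    absorb true  false = refl
    absorb true  true  = refl

  mod2Form-mutate : ∀ x → mod2Form (mutate k B) x ≡ mod2Form B x xor (dot x c ∧ dot x d)
  mod2Form-mutate x = begin
    quadratic (unitUpper P′) x
      ≡⟨ quadratic-cong (unitUpper P′) U+c⊗d symmetrisations-agree diagonals-agree x ⟩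
    quadratic U+c⊗d x
      ≡⟨ bilinear-+ᴹ U (λ i j → c i ∧ d j) x x ⟩
    quadratic U x xor bilinear (λ i j → c i ∧ d j) x x
      ≡⟨ cong (quadratic U x xor_) (bilinear-outer c d x x) ⟩
    quadratic U x xor (dot x c ∧ dot x d) ∎
    where
    open ≡-Reasoning
    skew′ = mutate-skew skew k

    U+c⊗d : Matrix n
    U+c⊗d i j = U i j xor (c i ∧ d j)

    symmetrisations-agree : ∀ i j → unitUpper P′ i j xor unitUpper P′ j i ≡ U+c⊗d i j xor U+c⊗d j i
    symmetrisations-agree i j = begin
      unitUpper P′ i j xor unitUpper P′ j i
        ≡⟨ unitUpper-symmetrisation P′ (parityMatrix-symmetric skew′) (parityMatrix-diagonal skew′) i j ⟩
      P′ i j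
        ≡⟨ odd-mutate i j ⟩
      P i j xor ((c i ∧ d j) xor (c j ∧ d i))
        ≡⟨ cong (_xor ((c i ∧ d j) xor (c j ∧ d i))) (sym (U-symmetrisation i j)) ⟩
      (U i j xor U j i) xor ((c i ∧ d j) xor (c j ∧ d i))
        ≡⟨ interchange (U i j) (U j i) (c i ∧ d j) (c j ∧ d i) ⟩
      U+c⊗d i j xor U+c⊗d j i ∎

    diagonals-agree : ∀ i → unitUpper P′ i i ≡ U+c⊗d i i
    diagonals-agree i = trans (unitUpper-diagonal P′ i)
                              (sym (cong₂ _xor_ (unitUpper-diagonal P i) (odd-pos-disjoint (B i k))))

  dot-transvection : ∀ x → dot (transvection x) c ≡ dot x c
  dot-transvection x = begin
    dot (λ i → x i xor basis k t i) c  ≡⟨ dot-+ˡ x (basis k t) c ⟩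
    t xor dot (basis k t) c            ≡⟨ cong (t xor_) (dot-basisˡ k t c) ⟩
    t xor (t ∧ c k)                    ≡⟨ cong (λ b → t xor (t ∧ b)) c-k ⟩
    t xor (t ∧ false)                  ≡⟨ cong (t xor_) (∧-zeroʳ t) ⟩
    t xor false                        ≡⟨ xor-identityʳ t ⟩
    t                                  ∎
    where
    open ≡-Reasoning
    t = dot x c

  transvection-cong : ∀ {x y} → x ≗ y → transvection x ≗ transvection y
  transvection-cong x≗y i =
    cong₂ (λ u t → u xor basis k t i) (x≗y i) (sum-cong-≋ {n} (λ j → cong (_∧ c j) (x≗y j)))

  transvection-linear : ∀ x y →
                        transvection (λ i → x i xor y i) ≗ (λ i → transvection x i xor transvection y i)
  transvection-linear x y i = begin
    (x i xor y i) xor basis k (dot (λ j → x j xor y j) c) i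
      ≡⟨ cong (λ t → (x i xor y i) xor basis k t i) (dot-+ˡ x y c) ⟩
    (x i xor y i) xor basis k (dot x c xor dot y c) i
      ≡⟨ cong ((x i xor y i) xor_) (basis-+ (does (i ≟ k))) ⟩
    (x i xor y i) xor (basis k (dot x c) i xor basis k (dot y c) i)
      ≡⟨ interchange (x i) (y i) _ _ ⟩
    transvection x i xor transvection y i ∎
    where
    open ≡-Reasoning
    basis-+ : ∀ b → (if b then dot x c xor dot y c else false) ≡
                    (if b then dot x c else false) xor (if b then dot y c else false)
    basis-+ true  = refl
    basis-+ false = refl

  transvection-involutive : ∀ x → transvection (transvection x) ≗ x
  transvection-involutive x i = begin
    transvection x i xor basis k (dot (transvection x) c) i
      ≡⟨ cong (λ t → transvection x i xor basis k t i) (dot-transvection x) ⟩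
    (x i xor e) xor e
      ≡⟨ xor-assoc (x i) e e ⟩
    x i xor (e xor e)
      ≡⟨ cong (x i xor_) (xor-same e) ⟩
    x i xor false
      ≡⟨ xor-identityʳ (x i) ⟩
    x i ∎
    where
    open ≡-Reasoning
    e = basis k (dot x c) i

involution-linearIso : ∀ {n} (f : Vector Bool n → Vector Bool n) →
                       (∀ {x y} → x ≗ y → f x ≗ f y) →
                       (∀ x y → f (λ i → x i xor y i) ≗ (λ i → f x i xor f y i)) →
                       (∀ x → f (f x) ≗ x) → LinearIso n
involution-linearIso {n} f f-cong f-linear f-involutive = record
  { to = F ; from = F ; to-linear = F-linear ; from∘to = F-involutive ; to∘from = F-involutive }
  where
  F : F2^ n → F2^ n
  F v = tabulate (f (lookup v))

  lookup-F : ∀ v → lookup (F v) ≗ f (lookup v)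
  lookup-F v = lookup∘tabulate (f (lookup v))

  lookup-injective : ∀ {v w : F2^ n} → lookup v ≗ lookup w → v ≡ w
  lookup-injective {v} {w} v≗w =
    trans (sym (tabulate∘lookup v)) (trans (tabulate-cong v≗w) (tabulate∘lookup w))

  F-linear : ∀ v w → F (v ⊕ w) ≡ F v ⊕ F w
  F-linear v w = lookup-injective λ i → begin
    lookup (F (v ⊕ w)) i                   ≡⟨ lookup-F (v ⊕ w) i ⟩
    f (lookup (v ⊕ w)) i                   ≡⟨ f-cong (λ j → lookup-zipWith _xor_ j v w) i ⟩
    f (λ j → lookup v j xor lookup w j) i  ≡⟨ f-linear (lookup v) (lookup w) i ⟩
    f (lookup v) i xor f (lookup w) i      ≡⟨ sym (cong₂ _xor_ (lookup-F v i) (lookup-F w i)) ⟩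
    lookup (F v) i xor lookup (F w) i      ≡⟨ sym (lookup-zipWith _xor_ i (F v) (F w)) ⟩
    lookup (F v ⊕ F w) i                   ∎
    where open ≡-Reasoning

  F-involutive : ∀ v → F (F v) ≡ v
  F-involutive v = lookup-injective λ i →
    trans (lookup-F (F v) i) (trans (f-cong (lookup-F v) i) (f-involutive (lookup v) i))

isoQuadForms-refl : ∀ {n} {q : F2^ n → Bool} → IsoQuadForms q q
isoQuadForms-refl = record { to = λ v → v ; from = λ v → v ; to-linear = λ _ _ → refl
                           ; from∘to = λ _ → refl ; to∘from = λ _ → refl } , λ _ → refl

isoQuadForms-trans : ∀ {n} {q q′ q″ : F2^ n → Bool} →
                     IsoQuadForms q q′ → IsoQuadForms q′ q″ → IsoQuadForms q q″
isoQuadForms-trans (S , qS≗q′) (T , q′T≗q″) = S∘T , λ v → trans (qS≗q′ (to T v)) (q′T≗q″ v)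
  where
  open LinearIso
  S∘T = record
    { to        = λ v → to S (to T v)
    ; from      = λ v → from T (from S v)
    ; to-linear = λ v w → trans (cong (to S) (to-linear T v w)) (to-linear S (to T v) (to T w))
    ; from∘to   = λ v → trans (cong (from T) (from∘to S (to T v))) (from∘to T v)
    ; to∘from   = λ v → trans (cong (to S) (to∘from T (from S v))) (to∘from S v)
    }

isoQuadForms-resp : ∀ {n} {q q′ r r′ : F2^ n → Bool} →
                    q ≗ r → q′ ≗ r′ → IsoQuadForms r r′ → IsoQuadForms q q′
isoQuadForms-resp q≗r q′≗r′ (T , rT≗r′) =
  T , λ v → trans (q≗r (LinearIso.to T v)) (trans (rT≗r′ v) (sym (q′≗r′ v)))

mutation-step : ∀ {n} {B B₁ : Mat n} → SkewSymmetric B → MutStep B B₁ →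
                SkewSymmetric B₁ × IsoQuadForms (mod2Form B ∘ lookup) (mod2Form B₁ ∘ lookup)
mutation-step {B = B} {B₁} skew (k , B₁≡μB) = skew₁ , (T , mod2Form-T)
  where
  open Mutation skew k

  T : LinearIso _
  T = involution-linearIso transvection transvection-cong transvection-linear transvection-involutive

  skew₁ : SkewSymmetric B₁
  skew₁ i j = trans (B₁≡μB i j) (trans (mutate-skew skew k i j) (cong -_ (sym (B₁≡μB j i))))

  mod2Form-T : ∀ v → mod2Form B (lookup (LinearIso.to T v)) ≡ mod2Form B₁ (lookup v)
  mod2Form-T v = begin
    mod2Form B (lookup (tabulate (transvection x)))
      ≡⟨ mod2Form-cong {B = B} (λ _ _ → refl) (lookup∘tabulate (transvection x)) ⟩
    mod2Form B (transvection x)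
      ≡⟨ mod2Form-transvection x ⟩
    mod2Form B x xor (dot x c ∧ dot x d)
      ≡⟨ sym (mod2Form-mutate x) ⟩
    mod2Form (mutate k B) x
      ≡⟨ mod2Form-cong {x = x} (λ i j → sym (B₁≡μB i j)) (λ _ → refl) ⟩
    mod2Form B₁ x ∎
    where
    open ≡-Reasoning
    x = lookup v

mutation-invariance : ∀ {n} {B B′ : Mat n} → SkewSymmetric B → MutationEquivalent B B′ →
                      IsoQuadForms (mod2Form B ∘ lookup) (mod2Form B′ ∘ lookup)
mutation-invariance {B = B} skew ε = isoQuadForms-refl {q = mod2Form B ∘ lookup}
mutation-invariance {B = B} {B′} skew (_◅_ {j = B₁} step B₁~B′) =
  let skew₁ , iso = mutation-step skew step
  in  isoQuadForms-trans {q = mod2Form B ∘ lookup} {mod2Form B₁ ∘ lookup} {mod2Form B′ ∘ lookup}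
                         iso (mutation-invariance skew₁ B₁~B′)

corollary1p6 : (n : ℕ) (B B′ A A′ : Mat n) →
    SkewSymmetric B → SkewSymmetric B′ →
    MutationEquivalent B B′ →
    QuasiCartanCompanion A B → QuasiCartanCompanion A′ B′ →
    IsoQuadForms (qForm A) (qForm A′)
corollary1p6 n B B′ A A′ skew skew′ B~B′ companion companion′ =
  isoQuadForms-resp (qForm≡mod2Form companion skew) (qForm≡mod2Form companion′ skew′)
                    (mutation-invariance skew B~B′)
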